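{- Let $a_{12},a_{13},a_{23}>0$ satisfy one of the following four conditions: (i) $a_{13}\ge 1$ and $a_{12},a_{23}>1$; (ii) $a_{12}\ge a_{13}\ge a_{23}=1$; (iii) $a_{23}\ge a_{13}\ge a_{12}=1$; (iv) $a_{13}>1$ and $a_{12},a_{23}<1$. Let $$A=\begin{bmatrix}1&a_{12}&a_{13}&1\\ \frac1{a_{12}}&1&a_{23}&1\\ \frac1{a_{13}}&\frac1{a_{23}}&1&1\\ 1&1&1&1\end{bmatrix}\in\mathcal{PC}_4 .$$ If $a_{13}\le a_{12}a_{23}$, then $\mathcal{C}(A)\subseteq\mathcal{E}(A)$.
   Context: $\mathcal{PC}_n$ denotes the set of $n$-by-$n$ reciprocal matrices, i.e. entrywise positive matrices $[a_{ij}]$ with $a_{ji}=1/a_{ij}$. A positive vector $w$ is efficient for $A=[a_{ij}]\in\mathcal{PC}_n$ if for every positive vector $v$, $|a_{ij}-v_i/v_j|\le|a_{ij}-w_i/w_j|$ for all $i,j$ implies $v$ is a positive multiple of $w$; $\mathcal{E}(A)$ is the set of efficient vectors for $A$. $\mathcal{C}(A)$ is the set of nonzero nonnegative linear combinations of the columns of $A$ (the zero vector excluded). -}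

module Defs where

open import Level using (0ℓ)
open import Data.Fin using (Fin; zero; suc)
open import Data.Product using (Σ; _×_; _,_)
open import Data.Sum using (_⊎_)
open import Relation.Nullary using (¬_)
open import Relation.Binary.Structures using (IsStrictTotalOrder)
open import Relation.Binary.Definitions using (tri<; tri≈; tri>)
open import Algebra.Bundles using (CommutativeRing)

-- The real numbers, axiomatised as a complete ordered field
-- (any two such structures are isomorphic, so quantifying over all of
-- them is the same as speaking about ℝ).
record RealField : Set₁ where
  field
    cring : CommutativeRing 0ℓ 0ℓ
  open CommutativeRing cring public hiding (zero)
  field
    _<_ : Carrier → Carrier → Set
    <-isStrictTotalOrder : IsStrictTotalOrder _≈_ _<_
    0<1 : 0# < 1#
    +-mono-< : ∀ {x y} z → x < y → (x + z) < (y + z)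
    *-pos : ∀ {x y} → 0# < x → 0# < y → 0# < (x * y)
    _⁻¹ : Carrier → Carrier
    ⁻¹-inverse : ∀ x → ¬ (x ≈ 0#) → (x * (x ⁻¹)) ≈ 1#
    sup : (S : Carrier → Set) → Σ Carrier S →
          Σ Carrier (λ b → ∀ x → S x → (x < b ⊎ x ≈ b)) →
          Σ Carrier (λ s → (∀ x → S x → (x < s ⊎ x ≈ s)) ×
                           (∀ b → (∀ x → S x → (x < b ⊎ x ≈ b)) → (s < b ⊎ s ≈ b)))

  infix 4 _≤_
  _≤_ : Carrier → Carrier → Set
  x ≤ y = x < y ⊎ x ≈ y

  _/_ : Carrier → Carrier → Carrier
  x / y = x * (y ⁻¹)

  ∣_∣ : Carrier → Carrier
  ∣ x ∣ with IsStrictTotalOrder.compare <-isStrictTotalOrder x 0#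
  ... | tri< _ _ _ = - x
  ... | tri≈ _ _ _ = x
  ... | tri> _ _ _ = x

  Pos : Carrier → Set
  Pos x = 0# < x

  Vec4 : Set
  Vec4 = Fin 4 → Carrier

  Mat4 : Set
  Mat4 = Fin 4 → Fin 4 → Carrier

  PositiveVec : Vec4 → Set
  PositiveVec w = ∀ i → Pos (w i)

  Efficient : Mat4 → Vec4 → Set
  Efficient A w =
    PositiveVec w ×
    (∀ (v : Vec4) → PositiveVec v →
       (∀ i j → ∣ A i j - (v i / v j) ∣ ≤ ∣ A i j - (w i / w j) ∣) →
       Σ Carrier (λ c → Pos c × (∀ i → v i ≈ (c * w i))))

  mulVec : Mat4 → Vec4 → Vec4
  mulVec A c i = ((A i zero * c zero + A i (suc zero) * c (suc zero))
                  + A i (suc (suc zero)) * c (suc (suc zero)))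
                  + A i (suc (suc (suc zero))) * c (suc (suc (suc zero)))

  InCone : Mat4 → Vec4 → Set
  InCone A w =
    Σ Vec4 (λ c → (∀ j → 0# ≤ c j) × (∀ i → w i ≈ mulVec A c i)) ×
    ¬ (∀ i → w i ≈ 0#)

  matA : Carrier → Carrier → Carrier → Mat4
  matA a12 a13 a23 zero zero = 1#
  matA a12 a13 a23 zero (suc zero) = a12
  matA a12 a13 a23 zero (suc (suc zero)) = a13
  matA a12 a13 a23 zero (suc (suc (suc zero))) = 1#
  matA a12 a13 a23 (suc zero) zero = 1# / a12
  matA a12 a13 a23 (suc zero) (suc zero) = 1#
  matA a12 a13 a23 (suc zero) (suc (suc zero)) = a23
  matA a12 a13 a23 (suc zero) (suc (suc (suc zero))) = 1#
  matA a12 a13 a23 (suc (suc zero)) zero = 1# / a13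
  matA a12 a13 a23 (suc (suc zero)) (suc zero) = 1# / a23
  matA a12 a13 a23 (suc (suc zero)) (suc (suc zero)) = 1#
  matA a12 a13 a23 (suc (suc zero)) (suc (suc (suc zero))) = 1#
  matA a12 a13 a23 (suc (suc (suc zero))) j = 1#

{-# OPTIONS --safe #-}
-- With a12, a13, a23 ≥ 1 (condition (iv) contradicts a13 ≤ a12 a23) and
-- a13 ≤ a12 a23, for each arc (i, j) of the cycle 0 → 3 → 2 → 1 → 0
-- (indices from 0, so a12 = A 0 1) row i of A dominates a_ij times row j.
-- Hence every w = A c with c ≥ 0 satisfies a_ij ≤ w_i / w_j along the cycle.
-- If v is at least as close to A as w entrywise, then on such an arc
-- v_i / v_j ≤ w_i / w_j, i.e. v_i / w_i ≤ v_j / w_j, and going once around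
-- the cycle forces v / w to be constant.
module Submission where

open import Level using (0ℓ)
open import Defs
open import Data.Fin using (Fin; zero; suc; #_)
open import Data.Product using (_×_; _,_; Σ)
open import Data.Sum using (_⊎_; inj₁; inj₂)
open import Relation.Nullary using (¬_; contradiction)
open import Relation.Binary.Bundles using (StrictTotalOrder)
open import Relation.Binary.Definitions using (tri<; tri≈; tri>)
open import Relation.Binary.Structures using (IsStrictTotalOrder)
import Algebra.Solver.CommutativeMonoid as CommutativeMonoidSolver
import Relation.Binary.Properties.StrictTotalOrder as StrictTotalOrderProperties
import Relation.Binary.Reasoning.StrictPartialOrder as StrictPartialOrderReasoning

module OrderedFieldProperties (R : RealField) where
  open RealField R
  open CommutativeMonoidSolver *-commutativeMonoid using (solve; _⊜_; _⊕_)
  open import Algebra.Properties.Ring ring using ([y-z]x≈yx-zx)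
  open import Algebra.Properties.AbelianGroup +-abelianGroup using (⁻¹-anti-homo‿-; //-rightDividesˡ; ε⁻¹≈ε)

  strictTotalOrder : StrictTotalOrder 0ℓ 0ℓ 0ℓ
  strictTotalOrder = record { isStrictTotalOrder = <-isStrictTotalOrder }

  open IsStrictTotalOrder <-isStrictTotalOrder public
    using (compare; <-respʳ-≈) renaming (irrefl to <-irrefl; asym to <-asym)
  open StrictTotalOrderProperties strictTotalOrder public
    using () renaming (refl to ≤-refl; reflexive to ≤-reflexive; trans to ≤-trans; antisym to ≤-antisym)
  open StrictPartialOrderReasoning (StrictTotalOrder.strictPartialOrder strictTotalOrder) public

  pos⇒≉0 : ∀ {x} → Pos x → ¬ (x ≈ 0#)
  pos⇒≉0 0<x x≈0 = <-irrefl (sym x≈0) 0<x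

  x<y⇒0<y-x : ∀ {x y} → x < y → 0# < (y - x)
  x<y⇒0<y-x {x} {y} x<y = begin-strict
    0#     ≈⟨ sym (-‿inverseʳ x) ⟩
    x - x  <⟨ +-mono-< (- x) x<y ⟩
    y - x  ∎

  0<y-x⇒x<y : ∀ {x y} → 0# < (y - x) → x < y
  0<y-x⇒x<y {x} {y} 0<y-x = begin-strict
    x            ≈⟨ sym (+-identityˡ x) ⟩
    0# + x       <⟨ +-mono-< x 0<y-x ⟩
    (y - x) + x  ≈⟨ //-rightDividesˡ x y ⟩
    y            ∎

  +-monoˡ-≤ : ∀ z {x y} → x ≤ y → x + z ≤ y + z
  +-monoˡ-≤ z (inj₁ x<y) = inj₁ (+-mono-< z x<y)
  +-monoˡ-≤ z (inj₂ x≈y) = inj₂ (+-congʳ x≈y)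

  +-mono-≤ : ∀ {x y u v} → x ≤ y → u ≤ v → x + u ≤ y + v
  +-mono-≤ {x} {y} {u} {v} x≤y u≤v = begin
    x + u  ≤⟨ +-monoˡ-≤ u x≤y ⟩
    y + u  ≈⟨ +-comm y u ⟩
    u + y  ≤⟨ +-monoˡ-≤ y u≤v ⟩
    v + y  ≈⟨ +-comm v y ⟩
    y + v  ∎

  +-pos-nonneg : ∀ {x y} → 0# < x → 0# ≤ y → 0# < (x + y)
  +-pos-nonneg {x} {y} 0<x 0≤y = begin-strict
    0#       ≈⟨ sym (+-identityʳ 0#) ⟩
    0# + 0#  <⟨ +-mono-< 0# 0<x ⟩
    x + 0#   ≤⟨ +-mono-≤ ≤-refl 0≤y ⟩
    x + y    ∎

  +-nonneg-pos : ∀ {x y} → 0# ≤ x → 0# < y → 0# < (x + y)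
  +-nonneg-pos {x} {y} 0≤x 0<y = <-respʳ-≈ (+-comm y x) (+-pos-nonneg 0<y 0≤x)

  +-nonneg : ∀ {x y} → 0# ≤ x → 0# ≤ y → 0# ≤ x + y
  +-nonneg 0≤x 0≤y = ≤-trans (≤-reflexive (sym (+-identityʳ 0#))) (+-mono-≤ 0≤x 0≤y)

  *-monoˡ-< : ∀ {x y z} → 0# < z → x < y → (x * z) < (y * z)
  *-monoˡ-< {x} {y} {z} 0<z x<y = 0<y-x⇒x<y (begin-strict
    0#             <⟨ *-pos (x<y⇒0<y-x x<y) 0<z ⟩
    (y - x) * z    ≈⟨ [y-z]x≈yx-zx z y x ⟩
    y * z - x * z  ∎)

  *-monoˡ-≤ : ∀ {x y z} → 0# ≤ z → x ≤ y → x * z ≤ y * z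
  *-monoˡ-≤ (inj₁ 0<z) (inj₁ x<y) = inj₁ (*-monoˡ-< 0<z x<y)
  *-monoˡ-≤ (inj₁ 0<z) (inj₂ x≈y) = inj₂ (*-congʳ x≈y)
  *-monoˡ-≤ {x} {y} {z} (inj₂ 0≈z) _ = inj₂ (begin-equality
    x * z   ≈⟨ *-congˡ (sym 0≈z) ⟩
    x * 0#  ≈⟨ zeroʳ x ⟩
    0#      ≈⟨ sym (zeroʳ y) ⟩
    y * 0#  ≈⟨ *-congˡ 0≈z ⟩
    y * z   ∎)

  *-monoʳ-≤ : ∀ {x y z} → 0# ≤ z → x ≤ y → z * x ≤ z * y
  *-monoʳ-≤ {x} {y} {z} 0≤z x≤y = begin
    z * x  ≈⟨ *-comm z x ⟩
    x * z  ≤⟨ *-monoˡ-≤ 0≤z x≤y ⟩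
    y * z  ≈⟨ *-comm y z ⟩
    z * y  ∎

  *-nonneg : ∀ {x y} → 0# ≤ x → 0# ≤ y → 0# ≤ x * y
  *-nonneg {x} {y} 0≤x 0≤y = begin
    0#      ≈⟨ sym (zeroˡ y) ⟩
    0# * y  ≤⟨ *-monoˡ-≤ 0≤y 0≤x ⟩
    x * y   ∎

  x*x⁻¹≈1 : ∀ {x} → Pos x → x * x ⁻¹ ≈ 1#
  x*x⁻¹≈1 0<x = ⁻¹-inverse _ (pos⇒≉0 0<x)

  ⁻¹-pos : ∀ {x} → Pos x → Pos (x ⁻¹)
  ⁻¹-pos {x} 0<x with compare (x ⁻¹) 0#
  ... | tri> _ _ 0<x⁻¹ = 0<x⁻¹
  ... | tri≈ _ x⁻¹≈0 _ = contradiction (begin-equality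
    1#        ≈⟨ sym (x*x⁻¹≈1 0<x) ⟩
    x * x ⁻¹  ≈⟨ *-congˡ x⁻¹≈0 ⟩
    x * 0#    ≈⟨ zeroʳ x ⟩
    0#        ∎) (pos⇒≉0 0<1)
  ... | tri< x⁻¹<0 _ _ = contradiction 0<1 (<-asym (begin-strict
    1#         ≈⟨ sym (x*x⁻¹≈1 0<x) ⟩
    x * x ⁻¹   ≈⟨ *-comm x (x ⁻¹) ⟩
    x ⁻¹ * x   <⟨ *-monoˡ-< 0<x x⁻¹<0 ⟩
    0# * x     ≈⟨ zeroˡ x ⟩
    0#         ∎))

  /-pos : ∀ {x y} → Pos x → Pos y → Pos (x / y)
  /-pos 0<x 0<y = *-pos 0<x (⁻¹-pos 0<y)

  x/y*y≈x : ∀ x {y} → Pos y → (x / y) * y ≈ x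
  x/y*y≈x x {y} 0<y = begin-equality
    (x * y ⁻¹) * y  ≈⟨ *-assoc x (y ⁻¹) y ⟩
    x * (y ⁻¹ * y)  ≈⟨ *-congˡ (trans (*-comm (y ⁻¹) y) (x*x⁻¹≈1 0<y)) ⟩
    x * 1#          ≈⟨ *-identityʳ x ⟩
    x               ∎

  x*y/y≈x : ∀ x {y} → Pos y → (x * y) / y ≈ x
  x*y/y≈x x {y} 0<y = begin-equality
    (x * y) * y ⁻¹  ≈⟨ *-assoc x y (y ⁻¹) ⟩
    x * (y * y ⁻¹)  ≈⟨ *-congˡ (x*x⁻¹≈1 0<y) ⟩
    x * 1#          ≈⟨ *-identityʳ x ⟩
    x               ∎

  x*1/x≈1 : ∀ {x} → Pos x → x * (1# / x) ≈ 1#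
  x*1/x≈1 {x} 0<x = trans (*-comm x (1# / x)) (x/y*y≈x 1# 0<x)

  x/y*y/z≈x/z : ∀ x {y} z → Pos y → (x / y) * (y / z) ≈ x / z
  x/y*y/z≈x/z x {y} z 0<y = begin-equality
    (x * y ⁻¹) * (y * z ⁻¹)  ≈⟨ solve 4 (λ x y y⁻¹ z⁻¹ → ((x ⊕ y⁻¹) ⊕ (y ⊕ z⁻¹)) ⊜ ((x ⊕ z⁻¹) ⊕ (y ⊕ y⁻¹))) refl x y (y ⁻¹) (z ⁻¹) ⟩
    (x * z ⁻¹) * (y * y ⁻¹)  ≈⟨ *-congˡ (x*x⁻¹≈1 0<y) ⟩
    (x * z ⁻¹) * 1#          ≈⟨ *-identityʳ _ ⟩
    x * z ⁻¹                 ∎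

  x*y≤z⇒x≤z/y : ∀ {x y z} → Pos y → x * y ≤ z → x ≤ z / y
  x*y≤z⇒x≤z/y {x} {y} {z} 0<y x*y≤z = begin
    x               ≈⟨ sym (x*y/y≈x x 0<y) ⟩
    (x * y) / y     ≤⟨ *-monoˡ-≤ (inj₁ (⁻¹-pos 0<y)) x*y≤z ⟩
    z / y           ∎

  x/y≤z/u⇒x/z≤y/u : ∀ {x y z u} → Pos y → Pos z → x / y ≤ z / u → x / z ≤ y / u
  x/y≤z/u⇒x/z≤y/u {x} {y} {z} {u} 0<y 0<z x/y≤z/u = begin
    x / z              ≈⟨ sym (x/y*y/z≈x/z x z 0<y) ⟩
    (x / y) * (y / z)  ≤⟨ *-monoˡ-≤ (inj₁ (/-pos 0<y 0<z)) x/y≤z/u ⟩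
    (z / u) * (y / z)  ≈⟨ *-comm (z / u) (y / z) ⟩
    (y / z) * (z / u)  ≈⟨ x/y*y/z≈x/z y u 0<z ⟩
    y / u              ∎

  1≤x⇒1/x≤1 : ∀ {x} → Pos x → 1# ≤ x → 1# / x ≤ 1#
  1≤x⇒1/x≤1 {x} 0<x 1≤x = begin
    1# / x         ≈⟨ sym (*-identityʳ (1# / x)) ⟩
    (1# / x) * 1#  ≤⟨ *-monoʳ-≤ (inj₁ (/-pos 0<1 0<x)) 1≤x ⟩
    (1# / x) * x   ≈⟨ x/y*y≈x 1# 0<x ⟩
    1#             ∎

  x≤y*z⇒1/y*x≤z : ∀ {x y z} → Pos y → x ≤ y * z → (1# / y) * x ≤ z
  x≤y*z⇒1/y*x≤z {x} {y} {z} 0<y x≤y*z = begin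
    (1# / y) * x        ≤⟨ *-monoʳ-≤ (inj₁ (/-pos 0<1 0<y)) x≤y*z ⟩
    (1# / y) * (y * z)  ≈⟨ sym (*-assoc (1# / y) y z) ⟩
    ((1# / y) * y) * z  ≈⟨ *-congʳ (x/y*y≈x 1# 0<y) ⟩
    1# * z              ≈⟨ *-identityˡ z ⟩
    z                   ∎

  x≤y*z⇒1/z*1/y≤1/x : ∀ {x y z} → Pos x → Pos y → Pos z → x ≤ y * z → (1# / z) * (1# / y) ≤ 1# / x
  x≤y*z⇒1/z*1/y≤1/x {x} {y} {z} 0<x 0<y 0<z x≤y*z = begin
    1/z * 1/y                        ≈⟨ sym (*-identityˡ _) ⟩
    1# * (1/z * 1/y)                 ≈⟨ *-congʳ (sym (x*1/x≈1 0<x)) ⟩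
    (x * 1/x) * (1/z * 1/y)          ≈⟨ *-assoc x 1/x _ ⟩
    x * (1/x * (1/z * 1/y))          ≤⟨ *-monoˡ-≤ (inj₁ (*-pos (/-pos 0<1 0<x) (*-pos (/-pos 0<1 0<z) (/-pos 0<1 0<y)))) x≤y*z ⟩
    (y * z) * (1/x * (1/z * 1/y))    ≈⟨ solve 5 (λ y z 1/x 1/y 1/z → ((y ⊕ z) ⊕ (1/x ⊕ (1/z ⊕ 1/y))) ⊜ (1/x ⊕ ((y ⊕ 1/y) ⊕ (z ⊕ 1/z)))) refl y z 1/x 1/y 1/z ⟩
    1/x * ((y * 1/y) * (z * 1/z))    ≈⟨ *-congˡ (*-cong (x*1/x≈1 0<y) (x*1/x≈1 0<z)) ⟩
    1/x * (1# * 1#)                  ≈⟨ *-congˡ (*-identityˡ 1#) ⟩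
    1/x * 1#                         ≈⟨ *-identityʳ 1/x ⟩
    1/x                              ∎
    where
    1/x 1/y 1/z : Carrier
    1/x = 1# / x
    1/y = 1# / y
    1/z = 1# / z

  x≤y⇒x-y≤0 : ∀ {x y} → x ≤ y → x - y ≤ 0#
  x≤y⇒x-y≤0 {x} {y} x≤y = ≤-trans (+-monoˡ-≤ (- y) x≤y) (≤-reflexive (-‿inverseʳ y))

  -x≤∣x∣ : ∀ x → - x ≤ ∣ x ∣
  -x≤∣x∣ x with compare x 0#
  ... | tri< _ _ _ = ≤-refl
  ... | tri≈ _ x≈0 _ = ≤-reflexive (begin-equality
    - x   ≈⟨ -‿cong x≈0 ⟩
    - 0#  ≈⟨ ε⁻¹≈ε ⟩
    0#    ≈⟨ sym x≈0 ⟩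
    x     ∎)
  ... | tri> _ _ 0<x = inj₁ (begin-strict
    - x         ≈⟨ sym (+-identityˡ (- x)) ⟩
    0# + - x    <⟨ +-mono-< (- x) 0<x ⟩
    x + - x     ≈⟨ -‿inverseʳ x ⟩
    0#          <⟨ 0<x ⟩
    x           ∎)

  x≤0⇒∣x∣≈-x : ∀ {x} → x ≤ 0# → ∣ x ∣ ≈ - x
  x≤0⇒∣x∣≈-x {x} x≤0 with compare x 0#
  ... | tri< _ _ _ = refl
  ... | tri≈ _ x≈0 _ = begin-equality
    x     ≈⟨ x≈0 ⟩
    0#    ≈⟨ sym ε⁻¹≈ε ⟩
    - 0#  ≈⟨ -‿cong (sym x≈0) ⟩
    - x   ∎
  ... | tri> _ _ 0<x = contradiction (begin-strict 0# <⟨ 0<x ⟩ x ≤⟨ x≤0 ⟩ 0# ∎) (<-irrefl refl)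

  a≤x∧∣a-y∣≤∣a-x∣⇒y≤x : ∀ {a x y} → a ≤ x → ∣ a - y ∣ ≤ ∣ a - x ∣ → y ≤ x
  a≤x∧∣a-y∣≤∣a-x∣⇒y≤x {a} {x} {y} a≤x ∣a-y∣≤∣a-x∣ = begin
    y              ≈⟨ sym (//-rightDividesˡ a y) ⟩
    (y - a) + a    ≈⟨ +-congʳ (sym (⁻¹-anti-homo‿- a y)) ⟩
    - (a - y) + a  ≤⟨ +-monoˡ-≤ a (≤-trans (-x≤∣x∣ (a - y)) ∣a-y∣≤∣a-x∣) ⟩
    ∣ a - x ∣ + a  ≈⟨ +-congʳ (x≤0⇒∣x∣≈-x (x≤y⇒x-y≤0 a≤x)) ⟩
    - (a - x) + a  ≈⟨ +-congʳ (⁻¹-anti-homo‿- a x) ⟩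
    (x - a) + a    ≈⟨ //-rightDividesˡ a x ⟩
    x              ∎

module Efficiency (R : RealField) where
  open RealField R
  open OrderedFieldProperties R

  -- The arc i → j of the digraph G(A, w) of Blanquero, Carrizosa and Conde,
  -- who show that w is efficient iff G(A, w) is strongly connected.
  Edge : Mat4 → Vec4 → Fin 4 → Fin 4 → Set
  Edge A w i j = A i j ≤ w i / w j

  RowDominance : Mat4 → Fin 4 → Fin 4 → Set
  RowDominance A i j = ∀ k → A i j * A j k ≤ A i k

  edge⇒ratio≤ : ∀ A {v w i j} → PositiveVec v → PositiveVec w → Edge A w i j →
                ∣ A i j - (v i / v j) ∣ ≤ ∣ A i j - (w i / w j) ∣ → v i / w i ≤ v j / w j
  edge⇒ratio≤ A {j = j} 0<v 0<w edge closer =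
    x/y≤z/u⇒x/z≤y/u (0<v j) (0<w _) (a≤x∧∣a-y∣≤∣a-x∣⇒y≤x edge closer)

  cycle⇒efficient : ∀ {A w} → PositiveVec w →
                    Edge A w (# 0) (# 3) → Edge A w (# 3) (# 2) → Edge A w (# 2) (# 1) → Edge A w (# 1) (# 0) →
                    Efficient A w
  cycle⇒efficient {A} {w} 0<w e₀₃ e₃₂ e₂₁ e₁₀ = 0<w , proportional
    where
    proportional : ∀ v → PositiveVec v →
                   (∀ i j → ∣ A i j - (v i / v j) ∣ ≤ ∣ A i j - (w i / w j) ∣) →
                   Σ Carrier (λ c → Pos c × (∀ i → v i ≈ (c * w i)))
    proportional v 0<v closer = r (# 0) , /-pos (0<v _) (0<w _) , v≈r₀w
      where
      r : Vec4
      r i = v i / w i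

      r-mono : ∀ {i j} → Edge A w i j → r i ≤ r j
      r-mono e = edge⇒ratio≤ A 0<v 0<w e (closer _ _)

      r₀≤r₃ : r (# 0) ≤ r (# 3)
      r₀≤r₃ = r-mono e₀₃
      r₃≤r₂ : r (# 3) ≤ r (# 2)
      r₃≤r₂ = r-mono e₃₂
      r₂≤r₁ : r (# 2) ≤ r (# 1)
      r₂≤r₁ = r-mono e₂₁
      r₁≤r₀ : r (# 1) ≤ r (# 0)
      r₁≤r₀ = r-mono e₁₀

      r≈r₀ : ∀ i → r i ≈ r (# 0)
      r≈r₀ zero                   = refl
      r≈r₀ (suc zero)             = ≤-antisym r₁≤r₀ (≤-trans r₀≤r₃ (≤-trans r₃≤r₂ r₂≤r₁))
      r≈r₀ (suc (suc zero))       = ≤-antisym (≤-trans r₂≤r₁ r₁≤r₀) (≤-trans r₀≤r₃ r₃≤r₂)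
      r≈r₀ (suc (suc (suc zero))) = ≤-antisym (≤-trans r₃≤r₂ (≤-trans r₂≤r₁ r₁≤r₀)) r₀≤r₃

      v≈r₀w : ∀ i → v i ≈ (r (# 0) * w i)
      v≈r₀w i = trans (sym (x/y*y≈x (v i) (0<w i))) (*-congʳ (r≈r₀ i))

  mulVec-mono : ∀ A B {c} i j → (∀ k → 0# ≤ c k) → (∀ k → A i k ≤ B j k) → mulVec A c i ≤ mulVec B c j
  mulVec-mono A B {c} i j 0≤c A≤B = +-mono-≤ (+-mono-≤ (+-mono-≤ (term (# 0)) (term (# 1))) (term (# 2))) (term (# 3))
    where
    term : ∀ k → A i k * c k ≤ B j k * c k
    term k = *-monoˡ-≤ (0≤c k) (A≤B k)

  *-distribˡ-mulVec : ∀ b A c i → b * mulVec A c i ≈ mulVec (λ i k → b * A i k) c i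
  *-distribˡ-mulVec b A c i =
    trans (distribˡ b _ _) (+-cong (trans (distribˡ b _ _) (+-cong (trans (distribˡ b _ _)
      (+-cong (term (# 0)) (term (# 1)))) (term (# 2)))) (term (# 3)))
    where
    term : ∀ k → b * (A i k * c k) ≈ (b * A i k) * c k
    term k = sym (*-assoc b (A i k) (c k))

  rowDominance⇒edge : ∀ {A c w i j} → (∀ k → 0# ≤ c k) → (∀ i → w i ≈ mulVec A c i) → PositiveVec w →
                      RowDominance A i j → Edge A w i j
  rowDominance⇒edge {A} {c} {w} {i} {j} 0≤c w≈Ac 0<w dom = x*y≤z⇒x≤z/y (0<w j) (begin
    A i j * w j           ≈⟨ *-congˡ (w≈Ac j) ⟩
    A i j * mulVec A c j  ≈⟨ *-distribˡ-mulVec (A i j) A c j ⟩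
    mulVec scaledA c j    ≤⟨ mulVec-mono scaledA A j i 0≤c dom ⟩
    mulVec A c i          ≈⟨ sym (w≈Ac i) ⟩
    w i                   ∎)
    where
    scaledA : Mat4
    scaledA i′ k = A i j * A i′ k

  nonneg⇒zero⊎pos : ∀ (c : Vec4) → (∀ k → 0# ≤ c k) → (∀ k → 0# ≈ c k) ⊎ Σ (Fin 4) (λ k → Pos (c k))
  nonneg⇒zero⊎pos c 0≤c with 0≤c (# 0) | 0≤c (# 1) | 0≤c (# 2) | 0≤c (# 3)
  ... | inj₁ 0<c₀ | _         | _         | _         = inj₂ (# 0 , 0<c₀)
  ... | inj₂ _    | inj₁ 0<c₁ | _         | _         = inj₂ (# 1 , 0<c₁)
  ... | inj₂ _    | inj₂ _    | inj₁ 0<c₂ | _         = inj₂ (# 2 , 0<c₂)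
  ... | inj₂ _    | inj₂ _    | inj₂ _    | inj₁ 0<c₃ = inj₂ (# 3 , 0<c₃)
  ... | inj₂ 0≈c₀ | inj₂ 0≈c₁ | inj₂ 0≈c₂ | inj₂ 0≈c₃ = inj₁ 0≈c
    where
    0≈c : ∀ k → 0# ≈ c k
    0≈c zero                   = 0≈c₀
    0≈c (suc zero)             = 0≈c₁
    0≈c (suc (suc zero))       = 0≈c₂
    0≈c (suc (suc (suc zero))) = 0≈c₃

  mulVec-zero : ∀ A {c} i → (∀ k → 0# ≈ c k) → mulVec A c i ≈ 0#
  mulVec-zero A {c} i 0≈c = begin-equality
    mulVec A c i           ≈⟨ +-cong (+-cong (+-cong (term (# 0)) (term (# 1))) (term (# 2))) (term (# 3)) ⟩
    ((0# + 0#) + 0#) + 0#  ≈⟨ +-identityʳ _ ⟩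
    (0# + 0#) + 0#         ≈⟨ +-identityʳ _ ⟩
    0# + 0#                ≈⟨ +-identityʳ 0# ⟩
    0#                     ∎
    where
    term : ∀ k → A i k * c k ≈ 0#
    term k = trans (*-congˡ (sym (0≈c k))) (zeroʳ (A i k))

  mulVec-pos : ∀ A {c} k → (∀ i j → Pos (A i j)) → (∀ j → 0# ≤ c j) → Pos (c k) → ∀ i → Pos (mulVec A c i)
  mulVec-pos A {c} k 0<A 0≤c 0<cₖ i = sum-pos k (*-pos (0<A i k) 0<cₖ)
    where
    0≤t : ∀ j → 0# ≤ A i j * c j
    0≤t j = *-nonneg (inj₁ (0<A i j)) (0≤c j)

    sum-pos : ∀ k → Pos (A i k * c k) → Pos (mulVec A c i)
    sum-pos zero                   0<t = +-pos-nonneg (+-pos-nonneg (+-pos-nonneg 0<t (0≤t _)) (0≤t _)) (0≤t _)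
    sum-pos (suc zero)             0<t = +-pos-nonneg (+-pos-nonneg (+-nonneg-pos (0≤t _) 0<t) (0≤t _)) (0≤t _)
    sum-pos (suc (suc zero))       0<t = +-pos-nonneg (+-nonneg-pos (+-nonneg (0≤t _) (0≤t _)) 0<t) (0≤t _)
    sum-pos (suc (suc (suc zero))) 0<t = +-nonneg-pos (+-nonneg (+-nonneg (0≤t _) (0≤t _)) (0≤t _)) 0<t

  inCone⇒positive : ∀ A {w} → (∀ i j → Pos (A i j)) → InCone A w → PositiveVec w
  inCone⇒positive A 0<A ((c , 0≤c , w≈Ac) , w≉0) i with nonneg⇒zero⊎pos c 0≤c
  ... | inj₁ 0≈c        = contradiction (λ i → trans (w≈Ac i) (mulVec-zero A i 0≈c)) w≉0
  ... | inj₂ (k , 0<cₖ) = <-respʳ-≈ (sym (w≈Ac i)) (mulVec-pos A k 0<A 0≤c 0<cₖ i)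

  cone⊆efficient : ∀ A → (∀ i j → Pos (A i j)) →
                   RowDominance A (# 0) (# 3) → RowDominance A (# 3) (# 2) →
                   RowDominance A (# 2) (# 1) → RowDominance A (# 1) (# 0) →
                   ∀ w → InCone A w → Efficient A w
  cone⊆efficient A 0<A d₀₃ d₃₂ d₂₁ d₁₀ w w∈C@((c , 0≤c , w≈Ac) , _) =
    cycle⇒efficient 0<w (edge d₀₃) (edge d₃₂) (edge d₂₁) (edge d₁₀)
    where
    0<w : PositiveVec w
    0<w = inCone⇒positive A 0<A w∈C

    edge : ∀ {i j} → RowDominance A i j → Edge A w i j
    edge = rowDominance⇒edge 0≤c w≈Ac 0<w

module MatrixA (R : RealField) {a12 a13 a23 : RealField.Carrier R} (0<a12 : RealField.Pos R a12)
               (0<a13 : RealField.Pos R a13) (0<a23 : RealField.Pos R a23) where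
  open RealField R
  open OrderedFieldProperties R
  open Efficiency R

  Conditions : Set
  Conditions = (1# ≤ a13 × 1# < a12 × 1# < a23)
             ⊎ (a13 ≤ a12 × a23 ≤ a13 × a23 ≈ 1#)
             ⊎ (a13 ≤ a23 × a12 ≤ a13 × a12 ≈ 1#)
             ⊎ (1# < a13 × a12 < 1# × a23 < 1#)

  conditions⇒1≤aᵢⱼ : Conditions → a13 ≤ a12 * a23 → 1# ≤ a12 × 1# ≤ a13 × 1# ≤ a23
  conditions⇒1≤aᵢⱼ (inj₁ (1≤a13 , 1<a12 , 1<a23)) _ = inj₁ 1<a12 , 1≤a13 , inj₁ 1<a23
  conditions⇒1≤aᵢⱼ (inj₂ (inj₁ (a13≤a12 , a23≤a13 , a23≈1))) _ =
    ≤-trans 1≤a13 a13≤a12 , 1≤a13 , ≤-reflexive (sym a23≈1)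
    where
    1≤a13 : 1# ≤ a13
    1≤a13 = ≤-trans (≤-reflexive (sym a23≈1)) a23≤a13
  conditions⇒1≤aᵢⱼ (inj₂ (inj₂ (inj₁ (a13≤a23 , a12≤a13 , a12≈1)))) _ =
    ≤-reflexive (sym a12≈1) , 1≤a13 , ≤-trans 1≤a13 a13≤a23
    where
    1≤a13 : 1# ≤ a13
    1≤a13 = ≤-trans (≤-reflexive (sym a12≈1)) a12≤a13
  conditions⇒1≤aᵢⱼ (inj₂ (inj₂ (inj₂ (1<a13 , a12<1 , a23<1)))) a13≤a12a23 =
    contradiction 1<1 (<-irrefl refl)
    where
    1<1 : 1# < 1#
    1<1 = begin-strict
      1#         <⟨ 1<a13 ⟩
      a13        ≤⟨ a13≤a12a23 ⟩
      a12 * a23  <⟨ *-monoˡ-< 0<a23 a12<1 ⟩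
      1# * a23   ≈⟨ *-identityˡ a23 ⟩
      a23        <⟨ a23<1 ⟩
      1#         ∎

  A : Mat4
  A = matA a12 a13 a23

  A-pos : ∀ i j → Pos (A i j)
  A-pos zero                   zero                   = 0<1
  A-pos zero                   (suc zero)             = 0<a12
  A-pos zero                   (suc (suc zero))       = 0<a13
  A-pos zero                   (suc (suc (suc zero))) = 0<1
  A-pos (suc zero)             zero                   = /-pos 0<1 0<a12
  A-pos (suc zero)             (suc zero)             = 0<1
  A-pos (suc zero)             (suc (suc zero))       = 0<a23
  A-pos (suc zero)             (suc (suc (suc zero))) = 0<1
  A-pos (suc (suc zero))       zero                   = /-pos 0<1 0<a13
  A-pos (suc (suc zero))       (suc zero)             = /-pos 0<1 0<a23
  A-pos (suc (suc zero))       (suc (suc zero))       = 0<1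
  A-pos (suc (suc zero))       (suc (suc (suc zero))) = 0<1
  A-pos (suc (suc (suc zero))) j                      = 0<1

  module _ (1≤a12 : 1# ≤ a12) (1≤a13 : 1# ≤ a13) (1≤a23 : 1# ≤ a23) (a13≤a12a23 : a13 ≤ a12 * a23) where

    rowDominance₀₃ : RowDominance A (# 0) (# 3)
    rowDominance₀₃ zero                   = ≤-reflexive (*-identityˡ 1#)
    rowDominance₀₃ (suc zero)             = ≤-trans (≤-reflexive (*-identityˡ 1#)) 1≤a12
    rowDominance₀₃ (suc (suc zero))       = ≤-trans (≤-reflexive (*-identityˡ 1#)) 1≤a13
    rowDominance₀₃ (suc (suc (suc zero))) = ≤-reflexive (*-identityˡ 1#)

    rowDominance₃₂ : RowDominance A (# 3) (# 2)
    rowDominance₃₂ zero                   = ≤-trans (≤-reflexive (*-identityˡ _)) (1≤x⇒1/x≤1 0<a13 1≤a13)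
    rowDominance₃₂ (suc zero)             = ≤-trans (≤-reflexive (*-identityˡ _)) (1≤x⇒1/x≤1 0<a23 1≤a23)
    rowDominance₃₂ (suc (suc zero))       = ≤-reflexive (*-identityˡ 1#)
    rowDominance₃₂ (suc (suc (suc zero))) = ≤-reflexive (*-identityˡ 1#)

    rowDominance₂₁ : RowDominance A (# 2) (# 1)
    rowDominance₂₁ zero                   = x≤y*z⇒1/z*1/y≤1/x 0<a13 0<a12 0<a23 a13≤a12a23
    rowDominance₂₁ (suc zero)             = ≤-reflexive (*-identityʳ _)
    rowDominance₂₁ (suc (suc zero))       = ≤-reflexive (x/y*y≈x 1# 0<a23)
    rowDominance₂₁ (suc (suc (suc zero))) = ≤-trans (≤-reflexive (*-identityʳ _)) (1≤x⇒1/x≤1 0<a23 1≤a23)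

    rowDominance₁₀ : RowDominance A (# 1) (# 0)
    rowDominance₁₀ zero                   = ≤-reflexive (*-identityʳ _)
    rowDominance₁₀ (suc zero)             = ≤-reflexive (x/y*y≈x 1# 0<a12)
    rowDominance₁₀ (suc (suc zero))       = x≤y*z⇒1/y*x≤z 0<a12 a13≤a12a23
    rowDominance₁₀ (suc (suc (suc zero))) = ≤-trans (≤-reflexive (*-identityʳ _)) (1≤x⇒1/x≤1 0<a12 1≤a12)

    A-cone⊆efficient : ∀ w → InCone A w → Efficient A w
    A-cone⊆efficient = cone⊆efficient A A-pos rowDominance₀₃ rowDominance₃₂ rowDominance₂₁ rowDominance₁₀

mainTheorem5 : (R : RealField) → let open RealField R in
    ∀ (a12 a13 a23 : Carrier) → Pos a12 → Pos a13 → Pos a23 →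
    ((1# ≤ a13 × 1# < a12 × 1# < a23)
      ⊎ (a13 ≤ a12 × a23 ≤ a13 × a23 ≈ 1#)
      ⊎ (a13 ≤ a23 × a12 ≤ a13 × a12 ≈ 1#)
      ⊎ (1# < a13 × a12 < 1# × a23 < 1#)) →
    a13 ≤ a12 * a23 →
    ∀ (w : Vec4) → InCone (matA a12 a13 a23) w → Efficient (matA a12 a13 a23) w
mainTheorem5 R a12 a13 a23 0<a12 0<a13 0<a23 conditions a13≤a12a23 =
  let 1≤a12 , 1≤a13 , 1≤a23 = conditions⇒1≤aᵢⱼ conditions a13≤a12a23
  in  A-cone⊆efficient 1≤a12 1≤a13 1≤a23 a13≤a12a23
  where open MatrixA R 0<a12 0<a13 0<a23
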